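{- For every odd integer $k \geq 3$, \[ P_k(k+1) < 0, \quad\text{where } P_k(m) = 2(m-1)^{k+1} + (k+1)(m-1)^{k} - 2(k+1)m^{k} + (k-1). \]
   Context: $P_k(m)$ equals $2(k+1)\left(S_{\mathbb{R}}(m-1,k) - m^k\right)$ with $S_{\mathbb{R}}(m-1,k) = \frac{(m-1)^{k+1}-1}{k+1} + \frac{1+(m-1)^k}{2}$. -}

module Defs where

open import Data.Nat as ℕ using (ℕ)
open import Data.Integer using (ℤ; +_; _+_; _-_; _*_; _^_)

P : ℕ → ℤ → ℤ
P k m = + 2 * (m - + 1) ^ ℕ.suc k
      + (+ k + + 1) * (m - + 1) ^ k
      - + 2 * (+ k + + 1) * m ^ k
      + (+ k - + 1)

{-# OPTIONS --safe #-}
module Submission where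

-- At m = k + 1 the polynomial is 2k^(k+1) + (k+1)k^k + k - 1 - 2(k+1)^(k+1).
-- Keeping the first two terms of the binomial expansion,
-- (k+1)^(k+1) ≥ k^(k+1) + (k+1)k^k, so 2(k+1)^(k+1) exceeds the positive part
-- by at least (k+1)k^k - k + 1 > 0.

open import Defs
open import Data.Nat as ℕ using (ℕ; zero; suc; _≥_; _%_)
import Data.Nat.Properties as ℕ
open import Relation.Binary.PropositionalEquality
  using (_≡_; refl; sym; trans; cong; cong₂; subst₂; module ≡-Reasoning)

module _ where
  open import Data.Nat using (_+_; _*_; _^_; _≤_; z≤n)
  open ℕ.≤-Reasoning
  open import Data.Nat.Tactic.RingSolver using (solve-∀)

  a^[1+n]+[n+1]a^n≤[a+1]^[1+n] : ∀ a n → a ^ suc n + (n + 1) * a ^ n ≤ (a + 1) ^ suc n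
  a^[1+n]+[n+1]a^n≤[a+1]^[1+n] a zero = ℕ.≤-reflexive (base a)
    where
    base : ∀ a → a * 1 + 1 * 1 ≡ (a + 1) * 1
    base = solve-∀
  a^[1+n]+[n+1]a^n≤[a+1]^[1+n] a (suc n) = begin
    a * p + (suc n + 1) * p                ≤⟨ ℕ.m≤m+n _ ((n + 1) * q) ⟩
    a * p + (suc n + 1) * p + (n + 1) * q  ≡⟨ factor a n q ⟩
    (a + 1) * (p + (n + 1) * q)            ≤⟨ ℕ.*-monoʳ-≤ (a + 1) (a^[1+n]+[n+1]a^n≤[a+1]^[1+n] a n) ⟩
    (a + 1) * (a + 1) ^ suc n              ∎
    where
    q = a ^ n
    p = a * q
    factor : ∀ a n q → a * (a * q) + (suc n + 1) * (a * q) + (n + 1) * q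
                     ≡ (a + 1) * (a * q + (n + 1) * q)
    factor = solve-∀

  n≤[n+1]*n^n : ∀ n → n ≤ (n + 1) * n ^ n
  n≤[n+1]*n^n zero = z≤n
  n≤[n+1]*n^n n@(suc _) = ℕ.≤-trans (ℕ.m≤m+n n 1) (ℕ.m≤m*n (n + 1) (n ^ n) {{ℕ.m^n≢0 n n}})

  2k^[1+k]+[k+1]k^k+k≤2[k+1]^[1+k] : ∀ k → 2 * k ^ suc k + (k + 1) * k ^ k + k ≤ 2 * (k + 1) ^ suc k
  2k^[1+k]+[k+1]k^k+k≤2[k+1]^[1+k] k = begin
    2 * k ^ suc k + c + k  ≤⟨ ℕ.+-monoʳ-≤ (2 * k ^ suc k + c) (n≤[n+1]*n^n k) ⟩
    2 * k ^ suc k + c + c  ≡⟨ double (k ^ suc k) c ⟩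
    2 * (k ^ suc k + c)    ≤⟨ ℕ.*-monoʳ-≤ 2 (a^[1+n]+[n+1]a^n≤[a+1]^[1+n] k k) ⟩
    2 * (k + 1) ^ suc k    ∎
    where
    c = (k + 1) * k ^ k
    double : ∀ u v → 2 * u + v + v ≡ 2 * (u + v)
    double = solve-∀

open import Data.Integer using (+_; _+_; _-_; _*_; _^_; _<_; 0ℤ)
open import Data.Integer.Properties using (pos-+; pos-*; [+m]-[+n]≡m⊖n; n⊖n≡0; ⊖-monoˡ-<)
open import Data.Integer.Tactic.RingSolver using (solve-∀)

pos-^ : ∀ m n → + (m ℕ.^ n) ≡ (+ m) ^ n
pos-^ m zero    = refl
pos-^ m (suc n) = trans (pos-* m (m ℕ.^ n)) (cong (+ m *_) (pos-^ m n))

m<n⇒+m-+n<0 : ∀ {m n} → m ℕ.< n → + m - + n < 0ℤ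
m<n⇒+m-+n<0 {m} {n} m<n =
  subst₂ _<_ (sym ([+m]-[+n]≡m⊖n m n)) (n⊖n≡0 n) (⊖-monoˡ-< n m<n)

P-at-succ : ∀ k → P k (+ k + + 1) ≡
  + (2 ℕ.* k ℕ.^ suc k ℕ.+ (k ℕ.+ 1) ℕ.* k ℕ.^ k ℕ.+ k) - + (2 ℕ.* (k ℕ.+ 1) ℕ.^ suc k ℕ.+ 1)
P-at-succ k = begin
  P k (K + + 1)
    ≡⟨ cong (λ d → + 2 * d ^ suc k + (K + + 1) * d ^ k - + 2 * (K + + 1) * (K + + 1) ^ k + (K - + 1))
            (i+1-1≡i K) ⟩
  + 2 * (K * X) + (K + + 1) * X - + 2 * (K + + 1) * Y + (K - + 1)
    ≡⟨ regroup K X Y ⟩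
  (+ 2 * (K * X) + (K + + 1) * X + K) - (+ 2 * ((K + + 1) * Y) + + 1)
    ≡⟨ sym (cong₂ _-_ cast-lower cast-upper) ⟩
  + (2 ℕ.* k ℕ.^ suc k ℕ.+ (k ℕ.+ 1) ℕ.* k ℕ.^ k ℕ.+ k) - + (2 ℕ.* (k ℕ.+ 1) ℕ.^ suc k ℕ.+ 1) ∎
  where
  open ≡-Reasoning
  K = + k
  X = K ^ k
  Y = (K + + 1) ^ k
  i+1-1≡i : ∀ i → i + + 1 - + 1 ≡ i
  i+1-1≡i = solve-∀
  regroup : ∀ K X Y → + 2 * (K * X) + (K + + 1) * X - + 2 * (K + + 1) * Y + (K - + 1)
                    ≡ (+ 2 * (K * X) + (K + + 1) * X + K) - (+ 2 * ((K + + 1) * Y) + + 1)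
  regroup = solve-∀
  x = k ℕ.^ k
  y = (k ℕ.+ 1) ℕ.^ k
  cast-lower : + (2 ℕ.* (k ℕ.* x) ℕ.+ (k ℕ.+ 1) ℕ.* x ℕ.+ k) ≡ + 2 * (K * X) + (K + + 1) * X + K
  cast-lower = trans (pos-+ (2 ℕ.* (k ℕ.* x) ℕ.+ (k ℕ.+ 1) ℕ.* x) k) (cong (_+ K)
    (trans (pos-+ (2 ℕ.* (k ℕ.* x)) ((k ℕ.+ 1) ℕ.* x)) (cong₂ _+_
      (trans (pos-* 2 (k ℕ.* x)) (cong (+ 2 *_) (pos-^ k (suc k))))
      (trans (pos-* (k ℕ.+ 1) x) (cong₂ _*_ (pos-+ k 1) (pos-^ k k))))))
  cast-upper : + (2 ℕ.* ((k ℕ.+ 1) ℕ.* y) ℕ.+ 1) ≡ + 2 * ((K + + 1) * Y) + + 1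
  cast-upper = trans (pos-+ (2 ℕ.* ((k ℕ.+ 1) ℕ.* y)) 1) (cong (_+ + 1)
    (trans (pos-* 2 ((k ℕ.+ 1) ℕ.* y)) (cong (+ 2 *_)
      (trans (pos-^ (k ℕ.+ 1) (suc k)) (cong (_^ suc k) (pos-+ k 1))))))

lemma12 : (k : ℕ) → k % 2 ≡ 1 → k ≥ 3 → P k (+ k + + 1) < + 0
lemma12 k _ _ rewrite P-at-succ k =
  m<n⇒+m-+n<0 (ℕ.≤-<-trans (2k^[1+k]+[k+1]k^k+k≤2[k+1]^[1+k] k) (ℕ.m<m+n _ ℕ.z<s))
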